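{- Let $k \geq 4$ be even and $0 < \epsilon < \frac{(k-1)!}{k^k}$. There exists $\gamma = \gamma(k,\epsilon)>0$ such that for every $n$, every prime $q$ and every $\epsilon$-balanced vector $v \in (\mathbb{Z}/q\mathbb{Z})^n$, $|B_q(v)| \geq \gamma\,|\operatorname{supp}(v)|^k$.
   Context: $V_{k,n}$ is the set of vectors in $\mathbb{Z}^n$ with exactly $k$ nonzero entries, where these nonzero entries, read in increasing order of coordinate index, are $1,-1,1,-1,\dots$. For a prime $q$ and $v\in(\mathbb{Z}/q\mathbb{Z})^n$, $B_q(v) = \{ w \in V_{k,n} : w\cdot v \neq 0 \text{ in } \mathbb{Z}/q\mathbb{Z}\}$. $\operatorname{supp}(v)$ is the set of coordinates where $v$ is nonzero. A vector $v$ is $\epsilon$-balanced if every nonzero element of $\mathbb{Z}/q\mathbb{Z}$ appears as an entry of $v$ at most $\epsilon|\operatorname{supp}(v)|$ times.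
   Formalization: The parameter ε ranges only over the rationals, and the constant γ is taken in the positive rationals. -}

module Defs where

open import Data.Nat as ℕ using (ℕ; zero; suc; _∸_; _^_)
open import Data.Nat.Combinatorics using ()
open import Data.Nat.Divisibility using (_∣?_)
open import Data.Nat.Base using (_!)
open import Data.Integer as ℤ using (ℤ; +_; -_; ∣_∣)
import Data.Integer.Properties as ℤP
open import Data.Fin using (Fin; toℕ)
import Data.Fin.Properties as FinP
import Data.Nat.Properties as ℕP
open import Data.Vec using (Vec; []; _∷_; lookup; toList; foldr; zipWith)
open import Data.List as List using (List; []; _∷_; length; filter; concatMap; allFin)
import Data.List.Properties as ListP
open import Data.Rational using (ℚ; _/_; 0ℚ)
open import Data.Bool using (Bool; true; false)
open import Relation.Nullary using (¬_; Dec; yes; no)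
open import Relation.Nullary.Decidable using (¬?; _×-dec_)
open import Relation.Binary.PropositionalEquality using (_≡_; _≢_)

toℚ : ℕ → ℚ
toℚ n = + n / 1

-- the threshold (k-1)!/k^k  (for k = 0 the value is irrelevant; we set 0)
threshold : ℕ → ℚ
threshold zero = 0ℚ
threshold (suc m) = _/_ (+ (m !)) (suc m ^ suc m) {{ℕP.m^n≢0 (suc m) (suc m)}}

alt : ℕ → List ℤ
alt zero = []
alt (suc zero) = + 1 ∷ []
alt (suc (suc k)) = + 1 ∷ - (+ 1) ∷ alt k

nonzeros : ∀ {n} → Vec ℤ n → List ℤ
nonzeros w = filter (λ x → ¬? (x ℤ.≟ + 0)) (toList w)

InV : (k : ℕ) {n : ℕ} → Vec ℤ n → Set
InV k w = nonzeros w ≡ alt k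

InV? : (k : ℕ) {n : ℕ} (w : Vec ℤ n) → Dec (InV k w)
InV? k w = ListP.≡-dec ℤ._≟_ (nonzeros w) (alt k)

-- all vectors in {-1,0,1}^n (each exactly once); every element of
-- V_{k,n} lies in this finite set
ternary : (n : ℕ) → List (Vec ℤ n)
ternary zero = [] ∷ []
ternary (suc n) =
  concatMap (λ w → (+ 0 ∷ w) ∷ (+ 1 ∷ w) ∷ (- (+ 1) ∷ w) ∷ []) (ternary n)

-- Z/qZ as Fin q, dot product lifted to ℤ

dot : ∀ {n q} → Vec ℤ n → Vec (Fin q) n → ℤ
dot w v = foldr _ ℤ._+_ (+ 0) (zipWith (λ a b → a ℤ.* + toℕ b) w v)

NonzeroDot : ∀ {n} (q : ℕ) → Vec ℤ n → Vec (Fin q) n → Set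
NonzeroDot q w v = ¬ (q Data.Nat.Divisibility.∣ ∣ dot w v ∣)

NonzeroDot? : ∀ {n} (q : ℕ) (w : Vec ℤ n) (v : Vec (Fin q) n) → Dec (NonzeroDot q w v)
NonzeroDot? q w v = ¬? (q ∣? ∣ dot w v ∣)

cardB : (k : ℕ) {n : ℕ} (q : ℕ) → Vec (Fin q) n → ℕ
cardB k {n} q v =
  length (filter (λ w → InV? k w ×-dec NonzeroDot? q w v) (ternary n))

countEq : ∀ {n q} → Fin q → Vec (Fin q) n → ℕ
countEq a v = length (filter (λ x → x FinP.≟ a) (toList v))

suppSize : ∀ {n q} → Vec (Fin q) n → ℕ
suppSize v = length (filter (λ x → ¬? (toℕ x ℕ.≟ 0)) (toList v))

Balanced : ∀ {n q} → ℚ → Vec (Fin q) n → Set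
Balanced {q = q} ε v =
  (a : Fin q) → toℕ a ≢ 0 →
  toℚ (countEq a v) Data.Rational.≤ ε Data.Rational.* toℚ (suppSize v)

module Submission where

-- Only the w ∈ V_{k,n} supported on supp v are counted. With s = |supp v| they correspond to the
-- C(s,k) chains i₁ < ⋯ < i_k in supp v, and w · v ≡ 0 (mod q) can hold for at most one value of
-- v[i_k] once i₁, …, i_{k-1} are fixed, so at most m · C(s,k-1) chains are bad, where m is the largest
-- multiplicity of a nonzero entry of v. Since (k-1)!/k^k ≤ 1/(4k) for k ≥ 4, ε-balance gives
-- 4k · m ≤ s; together with k · C(s,k) + (k-1) · C(s,k-1) = s · C(s,k-1) this leaves at least
-- s · C(s,k-1)/(2k) good chains, and s^j ≤ 2^j j! C(s,j) for 4j ≤ s turns that into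
-- |B_q(v)| ≥ s^k/(2^k k!).

open import Defs
open import Data.Bool using (Bool; true; false; not; if_then_else_)
open import Data.Fin using (Fin; zero; suc; toℕ)
open import Data.Integer as ℤ using (ℤ; +_; -_; -[1+_]; ∣_∣)
open import Data.List as List using (List; []; _∷_; length; filter)
open import Data.Product using (∃-syntax; _×_; _,_)
open import Data.Sum using (_⊎_; inj₁; inj₂)
open import Data.Vec using (Vec; []; _∷_)
open import Level using (0ℓ)
open import Relation.Binary.PropositionalEquality
  using (_≡_; _≢_; refl; sym; trans; cong; cong₂; subst; subst₂; module ≡-Reasoning)
open import Relation.Nullary using (¬_; yes; no; does)
open import Relation.Nullary.Decidable using (¬?; _×-dec_)
open import Relation.Unary using (Pred; Decidable; _⊆′_)

module Binomial where
  open import Data.Nat using (ℕ; zero; suc; _+_; _*_; _^_; _!; _≤_; z≤n)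
  open import Data.Nat.Properties
  open import Data.Nat.Combinatorics using (_C_; nC1≡n; nCk+nC[k+1]≡[n+1]C[k+1])
  open import Data.Nat.Tactic.RingSolver using (solve-∀)

  [k+1]*nC[k+1]+k*nCk≡n*nCk : ∀ n k → suc k * (n C suc k) + k * (n C k) ≡ n * (n C k)
  [k+1]*nC[k+1]+k*nCk≡n*nCk zero    zero    = refl
  [k+1]*nC[k+1]+k*nCk≡n*nCk zero    (suc k) = cong₂ _+_ (*-zeroʳ (suc (suc k))) (*-zeroʳ (suc k))
  [k+1]*nC[k+1]+k*nCk≡n*nCk (suc n) zero    =
    trans (cong (λ c → 1 * c + 0) (nC1≡n (suc n))) (trans (+-identityʳ _) (*-comm 1 (suc n)))
  [k+1]*nC[k+1]+k*nCk≡n*nCk (suc n) (suc k) = begin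
    suc (suc k) * (suc n C suc (suc k)) + suc k * (suc n C suc k)
      ≡⟨ cong₂ (λ x y → suc (suc k) * x + suc k * y)
           (sym (nCk+nC[k+1]≡[n+1]C[k+1] n (suc k))) (sym (nCk+nC[k+1]≡[n+1]C[k+1] n k)) ⟩
    suc (suc k) * (b + c) + suc k * (a + b)
      ≡⟨ regroup k a b c ⟩
    (suc (suc k) * c + suc k * b) + (suc k * b + k * a) + (a + b)
      ≡⟨ cong₂ (λ x y → x + y + (a + b))
           ([k+1]*nC[k+1]+k*nCk≡n*nCk n (suc k)) ([k+1]*nC[k+1]+k*nCk≡n*nCk n k) ⟩
    n * b + n * a + (a + b)
      ≡⟨ collect n a b ⟩
    suc n * (a + b)
      ≡⟨ cong (suc n *_) (nCk+nC[k+1]≡[n+1]C[k+1] n k) ⟩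
    suc n * (suc n C suc k) ∎
    where
    open ≡-Reasoning
    a b c : ℕ
    a = n C k
    b = n C suc k
    c = n C suc (suc k)
    regroup : ∀ k a b c → suc (suc k) * (b + c) + suc k * (a + b) ≡
                          (suc (suc k) * c + suc k * b) + (suc k * b + k * a) + (a + b)
    regroup = solve-∀
    collect : ∀ n a b → n * b + n * a + (a + b) ≡ suc n * (a + b)
    collect = solve-∀

  n*nCk≤2[1+k]*g : ∀ {n k g b} → g + b ≡ n C suc k → 4 * suc k * b ≤ n * (n C k) → 4 * k ≤ n →
                   n * (n C k) ≤ 2 * suc k * g
  n*nCk≤2[1+k]*g {n} {k} {g} {b} g+b≡nC[1+k] 4[1+k]b≤X 4k≤n =
    *-cancelˡ-≤ 2 (+-cancelʳ-≤ (2 * X) (2 * X) (2 * (2 * suc k * g)) (begin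
      2 * X + 2 * X                                ≡⟨ double X ⟩
      4 * X                                        ≡⟨ cong (4 *_) (sym ([k+1]*nC[k+1]+k*nCk≡n*nCk n k)) ⟩
      4 * (suc k * (n C suc k) + k * B)            ≡⟨ cong (λ c → 4 * (suc k * c + k * B)) (sym g+b≡nC[1+k]) ⟩
      4 * (suc k * (g + b) + k * B)                ≡⟨ expand k g b B ⟩
      4 * suc k * g + (4 * suc k * b + 4 * k * B)  ≤⟨ +-monoʳ-≤ (4 * suc k * g)
                                                        (+-mono-≤ 4[1+k]b≤X (*-monoˡ-≤ B 4k≤n)) ⟩
      4 * suc k * g + (X + X)                      ≡⟨ halve k g X ⟩
      2 * (2 * suc k * g) + 2 * X                  ∎))
    where
    open ≤-Reasoning
    B X : ℕ
    B = n C k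
    X = n * B
    double : ∀ x → 2 * x + 2 * x ≡ 4 * x
    double = solve-∀
    expand : ∀ k g b c → 4 * (suc k * (g + b) + k * c) ≡ 4 * suc k * g + (4 * suc k * b + 4 * k * c)
    expand = solve-∀
    halve : ∀ k g x → 4 * suc k * g + (x + x) ≡ 2 * (2 * suc k * g) + 2 * x
    halve = solve-∀

  n^k≤2^k*k!*nCk : ∀ {n} k → 4 * k ≤ n → n ^ k ≤ 2 ^ k * k ! * (n C k)
  n^[1+k]≤2^[1+k]*[1+k]!*g : ∀ {n k g b} → g + b ≡ n C suc k → 4 * suc k * b ≤ n * (n C k) →
                             4 * k ≤ n → n ^ suc k ≤ 2 ^ suc k * suc k ! * g

  n^k≤2^k*k!*nCk zero          _        = ≤-refl
  n^k≤2^k*k!*nCk {n} (suc k) 4[1+k]≤n =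
    n^[1+k]≤2^[1+k]*[1+k]!*g {n} {k} {n C suc k} {0} (+-identityʳ _)
      (≤-trans (≤-reflexive (*-zeroʳ (4 * suc k))) z≤n) (≤-trans (*-monoʳ-≤ 4 (n≤1+n k)) 4[1+k]≤n)

  n^[1+k]≤2^[1+k]*[1+k]!*g {n} {k} {g} g+b≡nC[1+k] 4[1+k]b≤X 4k≤n = begin
    n * n ^ k                      ≤⟨ *-monoʳ-≤ n (n^k≤2^k*k!*nCk k 4k≤n) ⟩
    n * (2 ^ k * k ! * (n C k))    ≡⟨ swap n (2 ^ k * k !) (n C k) ⟩
    2 ^ k * k ! * (n * (n C k))    ≤⟨ *-monoʳ-≤ (2 ^ k * k !) (n*nCk≤2[1+k]*g g+b≡nC[1+k] 4[1+k]b≤X 4k≤n) ⟩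
    2 ^ k * k ! * (2 * suc k * g)  ≡⟨ regroup (2 ^ k) (k !) k g ⟩
    2 * 2 ^ k * (suc k * k !) * g  ∎
    where
    open ≤-Reasoning
    swap : ∀ n p c → n * (p * c) ≡ p * (n * c)
    swap = solve-∀
    regroup : ∀ p f k g → p * f * (2 * suc k * g) ≡ 2 * p * (suc k * f) * g
    regroup = solve-∀

module Counting where
  open import Data.Nat using (ℕ; zero; suc; _+_; _*_; _^_; _!; _⊔_; _≤_; _<_; z≤n; s≤s)
  open import Data.Nat.Properties
  open import Data.Nat.Combinatorics using (_C_; nCk+nC[k+1]≡[n+1]C[k+1])
  open import Data.Nat.Divisibility using (_∣_; _∣?_; >⇒∤)
  open import Data.Nat.Tactic.RingSolver using (solve-∀)
  import Data.Fin.Properties as Fin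
  import Data.Integer.Properties as ℤ
  import Data.Integer.Divisibility.Signed as ℤ∣
  import Data.Integer.Tactic.RingSolver as ℤ-Solver
  import Data.List.Properties as List
  open import Data.List.Relation.Binary.Sublist.Propositional using (⊆-refl)
  open import Data.List.Relation.Binary.Sublist.Propositional.Properties using (filter⁺; length-mono-≤)
  open import Data.Empty using (⊥-elim)
  open Binomial

  module _ {A : Set} {P : Pred A 0ℓ} (P? : Decidable P) where

    indicator : A → ℕ
    indicator x = if does (P? x) then 1 else 0

    count : List A → ℕ
    count []       = 0
    count (x ∷ xs) = indicator x + count xs

    length-filter≡count : ∀ xs → length (filter P? xs) ≡ count xs
    length-filter≡count []       = refl
    length-filter≡count (x ∷ xs) with does (P? x)
    ... | true  = cong suc (length-filter≡count xs)
    ... | false = length-filter≡count xs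

    indicator≤1 : ∀ x → indicator x ≤ 1
    indicator≤1 x with does (P? x)
    ... | true  = ≤-refl
    ... | false = z≤n

    indicator-accept : ∀ {x} → P x → indicator x ≡ 1
    indicator-accept {x} px with P? x
    ... | yes _  = refl
    ... | no ¬px = ⊥-elim (¬px px)

    indicator-reject : ∀ {x} → ¬ P x → indicator x ≡ 0
    indicator-reject {x} ¬px with P? x
    ... | yes px = ⊥-elim (¬px px)
    ... | no _   = refl

  indicator-¬?+indicator : ∀ {A : Set} {P : Pred A 0ℓ} (P? : Decidable P) x →
                           indicator (λ y → ¬? (P? y)) x + indicator P? x ≡ 1
  indicator-¬?+indicator P? x with P? x
  ... | yes _ = refl
  ... | no _  = refl

  count-mono : ∀ {A : Set} {P Q : Pred A 0ℓ} (P? : Decidable P) (Q? : Decidable Q) →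
               P ⊆′ Q → ∀ xs → count P? xs ≤ count Q? xs
  count-mono P? Q? P⊆Q xs = subst₂ _≤_ (length-filter≡count P? xs) (length-filter≡count Q? xs)
    (length-mono-≤ (filter⁺ P? Q? (λ { refl → P⊆Q _ }) (⊆-refl {x = xs})))

  sign : Bool → ℤ
  sign true  = + 1
  sign false = - + 1

  alternating : ℕ → Bool → List ℤ
  alternating zero    σ = []
  alternating (suc j) σ = sign σ ∷ alternating j (not σ)

  alt≡alternating : ∀ k → alt k ≡ alternating k true
  alt≡alternating zero          = refl
  alt≡alternating (suc zero)    = refl
  alt≡alternating (suc (suc k)) = cong (λ xs → + 1 ∷ - + 1 ∷ xs) (alt≡alternating k)

  nonzeros-sign∷ : ∀ {n} σ (w : Vec ℤ n) → nonzeros (sign σ ∷ w) ≡ sign σ ∷ nonzeros w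
  nonzeros-sign∷ true  w = refl
  nonzeros-sign∷ false w = refl

  module _ {n} {P : Pred (Vec ℤ (suc n)) 0ℓ} (P? : Decidable P) where

    count-ternary-suc : count P? (ternary (suc n)) ≡
      count (λ w → P? (+ 0 ∷ w)) (ternary n) + count (λ w → P? (+ 1 ∷ w)) (ternary n) +
      count (λ w → P? (- + 1 ∷ w)) (ternary n)
    count-ternary-suc = split (ternary n)
      where
      split : ∀ ws → count P? (List.concatMap (λ w → (+ 0 ∷ w) ∷ (+ 1 ∷ w) ∷ (- + 1 ∷ w) ∷ []) ws) ≡
        count (λ w → P? (+ 0 ∷ w)) ws + count (λ w → P? (+ 1 ∷ w)) ws + count (λ w → P? (- + 1 ∷ w)) ws
      split []       = refl
      split (w ∷ ws) = trans (cong (λ t → a + (b + (c + t))) (split ws)) (interleave a b c _ _ _)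
        where
        a b c : ℕ
        a = indicator P? (+ 0 ∷ w)
        b = indicator P? (+ 1 ∷ w)
        c = indicator P? (- + 1 ∷ w)
        interleave : ∀ a b c x y z → a + (b + (c + (x + y + z))) ≡ (a + x) + (b + y) + (c + z)
        interleave = solve-∀

    count-ternary-suc-≥ : ∀ σ →
      count (λ w → P? (+ 0 ∷ w)) (ternary n) + count (λ w → P? (sign σ ∷ w)) (ternary n) ≤
      count P? (ternary (suc n))
    count-ternary-suc-≥ true  = ≤-trans (m≤m+n _ _) (≤-reflexive (sym count-ternary-suc))
    count-ternary-suc-≥ false =
      ≤-trans (+-monoˡ-≤ (count (λ w → P? (- + 1 ∷ w)) (ternary n)) (m≤m+n _ _))
        (≤-reflexive (sym count-ternary-suc))

  module _ (q : ℕ) where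

    Divisible : Pred ℤ 0ℓ
    Divisible r = q ∣ ∣ r ∣

    divisible? : Decidable Divisible
    divisible? r = q ∣? ∣ r ∣

    nondivisible? : Decidable (λ r → ¬ Divisible r)
    nondivisible? r = ¬? (divisible? r)

    shift : Bool → Fin q → ℤ → ℤ
    shift σ x r = sign σ ℤ.* + toℕ x ℤ.+ r

    -- chains f j σ v r is the sum of f (r + s₁ v[i₁] + ⋯ + sⱼ v[iⱼ]) over all i₁ < ⋯ < iⱼ in
    -- supp v, where the signs sᵢ alternate starting from sign σ.
    chains : ∀ {n} → (ℤ → ℕ) → ℕ → Bool → Vec (Fin q) n → ℤ → ℕ
    chains f zero    σ v               r = f r
    chains f (suc j) σ []              r = 0
    chains f (suc j) σ (zero ∷ v)      r = chains f (suc j) σ v r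
    chains f (suc j) σ (x@(suc _) ∷ v) r = chains f (suc j) σ v r + chains f j (not σ) v (shift σ x r)

    chains-+ : ∀ {n} {f g h : ℤ → ℕ} → (∀ r → f r + g r ≡ h r) →
               ∀ j σ (v : Vec (Fin q) n) r → chains f j σ v r + chains g j σ v r ≡ chains h j σ v r
    chains-+ f+g≡h zero    σ v               r = f+g≡h r
    chains-+ f+g≡h (suc j) σ []              r = refl
    chains-+ f+g≡h (suc j) σ (zero ∷ v)      r = chains-+ f+g≡h (suc j) σ v r
    chains-+ {f = f} {g} f+g≡h (suc j) σ (x@(suc _) ∷ v) r =
      trans (interchange (chains f (suc j) σ v r) (chains f j (not σ) v (shift σ x r))
                         (chains g (suc j) σ v r) (chains g j (not σ) v (shift σ x r)))
        (cong₂ _+_ (chains-+ f+g≡h (suc j) σ v r) (chains-+ f+g≡h j (not σ) v (shift σ x r)))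
      where
      interchange : ∀ a b c d → (a + b) + (c + d) ≡ (a + c) + (b + d)
      interchange = solve-∀

    chains-1 : ∀ {n} j σ (v : Vec (Fin q) n) r → chains (λ _ → 1) j σ v r ≡ suppSize v C j
    chains-1 zero    σ v               r = refl
    chains-1 (suc j) σ []              r = refl
    chains-1 (suc j) σ (zero ∷ v)      r = chains-1 (suc j) σ v r
    chains-1 (suc j) σ (x@(suc _) ∷ v) r = begin
      chains (λ _ → 1) (suc j) σ v r + chains (λ _ → 1) j (not σ) v (shift σ x r)
        ≡⟨ cong₂ _+_ (chains-1 (suc j) σ v r) (chains-1 j (not σ) v (shift σ x r)) ⟩
      suppSize v C suc j + suppSize v C j
        ≡⟨ +-comm (suppSize v C suc j) (suppSize v C j) ⟩
      suppSize v C j + suppSize v C suc j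
        ≡⟨ nCk+nC[k+1]≡[n+1]C[k+1] (suppSize v) j ⟩
      suc (suppSize v) C suc j ∎
      where open ≡-Reasoning

    good bad : ∀ {n} → ℕ → Bool → Vec (Fin q) n → ℤ → ℕ
    good = chains (indicator nondivisible?)
    bad  = chains (indicator divisible?)

    good+bad≡suppSizeCj : ∀ {n} j σ (v : Vec (Fin q) n) r → good j σ v r + bad j σ v r ≡ suppSize v C j
    good+bad≡suppSizeCj j σ v r =
      trans (chains-+ (indicator-¬?+indicator divisible?) j σ v r) (chains-1 j σ v r)

    module _ {P : Pred ℤ 0ℓ} (P? : Decidable P) where

      Matching : ∀ {n} → ℕ → Bool → Vec (Fin q) n → ℤ → Pred (Vec ℤ n) 0ℓ
      Matching j σ v r w = nonzeros w ≡ alternating j σ × P (dot w v ℤ.+ r)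

      matching? : ∀ {n} j σ (v : Vec (Fin q) n) r → Decidable (Matching j σ v r)
      matching? j σ v r w =
        List.≡-dec ℤ._≟_ (nonzeros w) (alternating j σ) ×-dec P? (dot w v ℤ.+ r)

      #matching : ∀ {n} → ℕ → Bool → Vec (Fin q) n → ℤ → ℕ
      #matching {n} j σ v r = count (matching? j σ v r) (ternary n)

      matching-zero∷ : ∀ {n} j σ x (v : Vec (Fin q) n) r →
                       Matching j σ v r ⊆′ λ w → Matching j σ (x ∷ v) r (+ 0 ∷ w)
      matching-zero∷ j σ x v r w (shape , p) =
        shape , subst P (cong (ℤ._+ r) (sym (ℤ.+-identityˡ (dot w v)))) p

      matching-sign∷ : ∀ {n} j σ x (v : Vec (Fin q) n) r →
                       Matching j (not σ) v (shift σ x r) ⊆′ λ w → Matching (suc j) σ (x ∷ v) r (sign σ ∷ w)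
      matching-sign∷ j σ x v r w (shape , p) =
        trans (nonzeros-sign∷ σ w) (cong (sign σ ∷_) shape) ,
        subst P (reassociate (sign σ ℤ.* + toℕ x) (dot w v) r) p
        where
        reassociate : ∀ a d r → d ℤ.+ (a ℤ.+ r) ≡ a ℤ.+ d ℤ.+ r
        reassociate = ℤ-Solver.solve-∀

      #matching-zero∷ : ∀ {n} j σ x (v : Vec (Fin q) n) r → #matching j σ v r ≤ #matching j σ (x ∷ v) r
      #matching-zero∷ {n} j σ x v r = begin
        count (matching? j σ v r) (ternary n)
          ≤⟨ count-mono (matching? j σ v r) (λ w → matching? j σ (x ∷ v) r (+ 0 ∷ w))
                        (matching-zero∷ j σ x v r) (ternary n) ⟩
        count (λ w → matching? j σ (x ∷ v) r (+ 0 ∷ w)) (ternary n)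
          ≤⟨ m≤m+n _ _ ⟩
        count (λ w → matching? j σ (x ∷ v) r (+ 0 ∷ w)) (ternary n) +
        count (λ w → matching? j σ (x ∷ v) r (+ 1 ∷ w)) (ternary n)
          ≤⟨ count-ternary-suc-≥ (matching? j σ (x ∷ v) r) true ⟩
        count (matching? j σ (x ∷ v) r) (ternary (suc n)) ∎
        where open ≤-Reasoning

      #matching-∷ : ∀ {n} j σ x (v : Vec (Fin q) n) r →
                    #matching (suc j) σ v r + #matching j (not σ) v (shift σ x r) ≤
                    #matching (suc j) σ (x ∷ v) r
      #matching-∷ {n} j σ x v r =
        ≤-trans (+-mono-≤ (count-mono (matching? (suc j) σ v r) (λ w → matching? (suc j) σ (x ∷ v) r (+ 0 ∷ w))
                                      (matching-zero∷ (suc j) σ x v r) (ternary n))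
                          (count-mono (matching? j (not σ) v (shift σ x r))
                                      (λ w → matching? (suc j) σ (x ∷ v) r (sign σ ∷ w))
                                      (matching-sign∷ j σ x v r) (ternary n)))
          (count-ternary-suc-≥ (matching? (suc j) σ (x ∷ v) r) σ)

      chains-≤-#matching : ∀ {n} j σ (v : Vec (Fin q) n) r →
                           chains (indicator P?) j σ v r ≤ #matching j σ v r
      chains-≤-#matching zero σ [] r with P? r
      ... | yes p = ≤-trans (≤-reflexive (sym (indicator-accept (matching? zero σ [] r) {[]}
                                                  (refl , subst P (sym (ℤ.+-identityˡ r)) p))))
                            (m≤m+n _ 0)
      ... | no _  = z≤n
      chains-≤-#matching zero    σ (x ∷ v)         r =
        ≤-trans (chains-≤-#matching zero σ v r) (#matching-zero∷ zero σ x v r)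
      chains-≤-#matching (suc j) σ []              r = z≤n
      chains-≤-#matching (suc j) σ (zero ∷ v)      r =
        ≤-trans (chains-≤-#matching (suc j) σ v r) (#matching-zero∷ (suc j) σ zero v r)
      chains-≤-#matching (suc j) σ (x@(suc _) ∷ v) r =
        ≤-trans (+-mono-≤ (chains-≤-#matching (suc j) σ v r)
                          (chains-≤-#matching j (not σ) v (shift σ x r)))
          (#matching-∷ j σ x v r)

    good≤cardB : ∀ {n} k (v : Vec (Fin q) n) → good k true v (+ 0) ≤ cardB k q v
    good≤cardB {n} k v = begin
      good k true v (+ 0)                     ≤⟨ chains-≤-#matching nondivisible? k true v (+ 0) ⟩
      #matching nondivisible? k true v (+ 0)  ≤⟨ count-mono (matching? nondivisible? k true v (+ 0)) inB?
                                                   matching⇒inB (ternary n) ⟩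
      count inB? (ternary n)                  ≡⟨ length-filter≡count inB? (ternary n) ⟨
      cardB k q v                             ∎
      where
      open ≤-Reasoning
      inB? : Decidable (λ w → InV k w × NonzeroDot q w v)
      inB? w = InV? k w ×-dec NonzeroDot? q w v
      matching⇒inB : Matching nondivisible? k true v (+ 0) ⊆′ λ w → InV k w × NonzeroDot q w v
      matching⇒inB w (shape , nondivisible) =
        trans shape (sym (alt≡alternating k)) ,
        λ divisible → nondivisible (subst Divisible (sym (ℤ.+-identityʳ (dot w v))) divisible)

    countEq-∷ : ∀ {n} a x (v : Vec (Fin q) n) → countEq a v ≤ countEq a (x ∷ v)
    countEq-∷ a x v with x Fin.≟ a
    ... | yes _ = n≤1+n _
    ... | no _  = ≤-refl

    countEq-∷-self : ∀ {n} x (v : Vec (Fin q) n) → countEq x (x ∷ v) ≡ suc (countEq x v)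
    countEq-∷-self x v = cong length (List.filter-accept (λ y → y Fin.≟ x) refl)

    nonzero-entry : ∀ {n} (v : Vec (Fin q) n) → 0 < suppSize v → ∃[ a ] toℕ a ≢ 0 × 0 < countEq a v
    nonzero-entry (zero ∷ v) 0<s with nonzero-entry v 0<s
    ... | a , a≢0 , 0<count = a , a≢0 , ≤-trans 0<count (countEq-∷ a zero v)
    nonzero-entry (x@(suc _) ∷ v) _ =
      x , (λ ()) , ≤-trans (s≤s z≤n) (≤-reflexive (sym (countEq-∷-self x v)))

    MultiplicityBound : ∀ {n} → ℕ → ℕ → Vec (Fin q) n → Set
    MultiplicityBound D N v = ∀ a → toℕ a ≢ 0 → D * countEq a v ≤ N

    multiplicityBound-∷ : ∀ {n N} D x (v : Vec (Fin q) n) →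
                          MultiplicityBound D N (x ∷ v) → MultiplicityBound D N v
    multiplicityBound-∷ D x v bound a a≢0 = ≤-trans (*-monoʳ-≤ D (countEq-∷ a x v)) (bound a a≢0)

    suppSize≡0⊎≤suppSize : ∀ {n} D (v : Vec (Fin q) n) → MultiplicityBound D (suppSize v) v →
                           suppSize v ≡ 0 ⊎ D ≤ suppSize v
    suppSize≡0⊎≤suppSize D v bound with suppSize v Data.Nat.≟ 0
    ... | yes s≡0 = inj₁ s≡0
    ... | no s≢0 with nonzero-entry v (n≢0⇒n>0 s≢0)
    ...   | a , a≢0 , 0<count = inj₂ (begin
      D                ≡⟨ *-identityʳ D ⟨
      D * 1            ≤⟨ *-monoʳ-≤ D 0<count ⟩
      D * countEq a v  ≤⟨ bound a a≢0 ⟩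
      suppSize v       ∎)
      where open ≤-Reasoning

    ∣+m-+n∣<q : ∀ {m n} → m < q → n < q → ∣ + m ℤ.- + n ∣ < q
    ∣+m-+n∣<q {m} {n} m<q n<q = begin-strict
      ∣ + m ℤ.- + n ∣  ≡⟨ cong ∣_∣ (ℤ.m-n≡m⊖n m n) ⟩
      ∣ m ℤ.⊖ n ∣      ≤⟨ ℤ.∣m⊝n∣≤m⊔n m n ⟩
      m ⊔ n            <⟨ ⊔-lub m<q n<q ⟩
      q                ∎
      where open ≤-Reasoning

    ∣sign*i∣≡∣i∣ : ∀ σ i → ∣ sign σ ℤ.* i ∣ ≡ ∣ i ∣
    ∣sign*i∣≡∣i∣ true  i = trans (ℤ.abs-* (+ 1) i) (*-identityˡ ∣ i ∣)
    ∣sign*i∣≡∣i∣ false i = trans (ℤ.abs-* (- + 1) i) (*-identityˡ ∣ i ∣)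

    shift-divisible-unique : ∀ σ r {a b} → Divisible (shift σ a r) → Divisible (shift σ b r) → a ≡ b
    shift-divisible-unique σ r {a} {b} q∣a q∣b =
      Fin.toℕ-injective (ℤ.+-injective (ℤ.i-j≡0⇒i≡j _ _ (ℤ.∣i∣≡0⇒i≡0 ∣a-b∣≡0)))
      where
      difference : ∀ s a b r → (s ℤ.* a ℤ.+ r) ℤ.- (s ℤ.* b ℤ.+ r) ≡ s ℤ.* (a ℤ.- b)
      difference = ℤ-Solver.solve-∀
      ∣shift-shift∣ : ∣ shift σ a r ℤ.- shift σ b r ∣ ≡ ∣ + toℕ a ℤ.- + toℕ b ∣
      ∣shift-shift∣ = trans (cong ∣_∣ (difference (sign σ) (+ toℕ a) (+ toℕ b) r)) (∣sign*i∣≡∣i∣ σ _)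
      q∣a-b : q ∣ ∣ + toℕ a ℤ.- + toℕ b ∣
      q∣a-b = subst (q ∣_) ∣shift-shift∣
        (ℤ∣.∣⇒∣ᵤ (ℤ∣.∣m∣n⇒∣m-n (ℤ∣.∣ᵤ⇒∣ {+ q} {shift σ a r} q∣a) (ℤ∣.∣ᵤ⇒∣ {+ q} {shift σ b r} q∣b)))
      ∣a-b∣≡0 : ∣ + toℕ a ℤ.- + toℕ b ∣ ≡ 0
      ∣a-b∣≡0 with ∣ + toℕ a ℤ.- + toℕ b ∣ | q∣a-b | ∣+m-+n∣<q (Fin.toℕ<n a) (Fin.toℕ<n b)
      ... | zero  | _   | _   = refl
      ... | suc _ | q∣m | m<q = ⊥-elim (>⇒∤ m<q q∣m)

    bad₁-∷-≤ : ∀ {n} σ r x (v : Vec (Fin q) n) → bad 1 σ (x ∷ v) r ≤ suc (bad 1 σ v r)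
    bad₁-∷-≤ σ r zero      v = n≤1+n (bad 1 σ v r)
    bad₁-∷-≤ σ r x@(suc _) v =
      ≤-trans (+-monoʳ-≤ (bad 1 σ v r) (indicator≤1 divisible? (shift σ x r))) (≤-reflexive (+-comm _ 1))

    bad₁-∷-reject : ∀ {n} σ r x (v : Vec (Fin q) n) → ¬ Divisible (shift σ x r) →
                    bad 1 σ (x ∷ v) r ≡ bad 1 σ v r
    bad₁-∷-reject σ r zero      v _   = refl
    bad₁-∷-reject σ r x@(suc _) v q∤x =
      trans (cong (_+_ (bad 1 σ v r)) (indicator-reject divisible? {shift σ x r} q∤x)) (+-identityʳ _)

    -- At most one residue c satisfies q ∣ sign σ · c + r, so every one-element bad chain sits at an
    -- occurrence of c.
    bad₁≤countEq : ∀ {n} σ r {c} → Divisible (shift σ c r) → (v : Vec (Fin q) n) → bad 1 σ v r ≤ countEq c v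
    bad₁≤countEq σ r q∣c []          = z≤n
    bad₁≤countEq σ r {c} q∣c (x ∷ v) with divisible? (shift σ x r)
    ... | no q∤x = begin
      bad 1 σ (x ∷ v) r  ≡⟨ bad₁-∷-reject σ r x v q∤x ⟩
      bad 1 σ v r        ≤⟨ bad₁≤countEq σ r q∣c v ⟩
      countEq c v        ≤⟨ countEq-∷ c x v ⟩
      countEq c (x ∷ v)  ∎
      where open ≤-Reasoning
    ... | yes q∣x with shift-divisible-unique σ r q∣x q∣c
    ...   | refl = begin
      bad 1 σ (x ∷ v) r  ≤⟨ bad₁-∷-≤ σ r x v ⟩
      suc (bad 1 σ v r)  ≤⟨ s≤s (bad₁≤countEq σ r q∣c v) ⟩
      suc (countEq x v)  ≡⟨ countEq-∷-self x v ⟨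
      countEq x (x ∷ v)  ∎
      where open ≤-Reasoning

    bad₁-bound : ∀ {n N} D (v : Vec (Fin q) n) → MultiplicityBound D N v → ∀ σ r → D * bad 1 σ v r ≤ N
    bad₁-bound D []              _     σ r = ≤-trans (≤-reflexive (*-zeroʳ D)) z≤n
    bad₁-bound D (zero ∷ v)      bound σ r = bad₁-bound D v (multiplicityBound-∷ D zero v bound) σ r
    bad₁-bound D (x@(suc _) ∷ v) bound σ r with divisible? (shift σ x r)
    ... | no q∤x  = ≤-trans (≤-reflexive (cong (D *_) (bad₁-∷-reject σ r x v q∤x)))
                            (bad₁-bound D v (multiplicityBound-∷ D x v bound) σ r)
    ... | yes q∣x = ≤-trans (*-monoʳ-≤ D (bad₁≤countEq σ r q∣x (x ∷ v))) (bound x (λ ()))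

    bad-bound : ∀ {n N} D (v : Vec (Fin q) n) → MultiplicityBound D N v →
                ∀ j σ r → D * bad (suc j) σ v r ≤ N * (suppSize v C j)
    bad-bound {N = N} D v bound zero σ r =
      ≤-trans (bad₁-bound D v bound σ r) (≤-reflexive (sym (*-identityʳ N)))
    bad-bound D []         _     (suc j) σ r = ≤-trans (≤-reflexive (*-zeroʳ D)) z≤n
    bad-bound D (zero ∷ v) bound (suc j) σ r =
      bad-bound D v (multiplicityBound-∷ D zero v bound) (suc j) σ r
    bad-bound {N = N} D (x@(suc _) ∷ v) bound (suc j) σ r = begin
      D * (bad (suc (suc j)) σ v r + bad (suc j) (not σ) v r′)
        ≡⟨ *-distribˡ-+ D (bad (suc (suc j)) σ v r) (bad (suc j) (not σ) v r′) ⟩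
      D * bad (suc (suc j)) σ v r + D * bad (suc j) (not σ) v r′
        ≤⟨ +-mono-≤ (bad-bound D v bound′ (suc j) σ r) (bad-bound D v bound′ j (not σ) r′) ⟩
      N * (s C suc j) + N * (s C j)
        ≡⟨ *-distribˡ-+ N (s C suc j) (s C j) ⟨
      N * (s C suc j + s C j)
        ≡⟨ cong (N *_) (trans (+-comm (s C suc j) (s C j)) (nCk+nC[k+1]≡[n+1]C[k+1] s j)) ⟩
      N * (suc s C suc j) ∎
      where
      open ≤-Reasoning
      r′ : ℤ
      r′ = shift σ x r
      s : ℕ
      s = suppSize v
      bound′ : MultiplicityBound D N v
      bound′ = multiplicityBound-∷ D x v bound

    suppSize^[1+k]≤cardB : ∀ {n} k (v : Vec (Fin q) n) → MultiplicityBound (4 * suc k) (suppSize v) v →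
                           suppSize v ^ suc k ≤ 2 ^ suc k * suc k ! * cardB (suc k) q v
    suppSize^[1+k]≤cardB k v bound with suppSize≡0⊎≤suppSize (4 * suc k) v bound
    ... | inj₁ s≡0       = ≤-trans (≤-reflexive (cong (_^ suc k) s≡0)) z≤n
    ... | inj₂ 4[1+k]≤s = begin
      suppSize v ^ suc k
        ≤⟨ n^[1+k]≤2^[1+k]*[1+k]!*g (good+bad≡suppSizeCj (suc k) true v (+ 0))
             (bad-bound (4 * suc k) v bound k true (+ 0)) (≤-trans (*-monoʳ-≤ 4 (n≤1+n k)) 4[1+k]≤s) ⟩
      2 ^ suc k * suc k ! * good (suc k) true v (+ 0)
        ≤⟨ *-monoʳ-≤ (2 ^ suc k * suc k !) (good≤cardB (suc k) v) ⟩
      2 ^ suc k * suc k ! * cardB (suc k) q v ∎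
      where open ≤-Reasoning

module Balance where
  open import Data.Nat as ℕ using (ℕ; zero; suc; _+_; _*_; _^_; _!; _≤_; _<_; z≤n; s≤s)
  open import Data.Nat.Properties
  open import Data.Nat.Coprimality using (Coprime)
  open import Data.Nat.Tactic.RingSolver using (solve-∀)
  import Data.Integer.Properties as ℤ
  open import Data.Rational as ℚ using (ℚ; mkℚ; 0ℚ; _/_; toℚᵘ)
  import Data.Rational.Properties as ℚP
  open import Data.Rational.Unnormalised as ℚᵘ using (mkℚᵘ; *≤*; *<*)
  import Data.Rational.Unnormalised.Properties as ℚᵘP
  open Counting using (MultiplicityBound)

  toℚᵘ-/ : ∀ i n .{{_ : ℕ.NonZero n}} → toℚᵘ (i / n) ℚᵘ.≃ mkℚᵘ i (ℕ.pred n)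
  toℚᵘ-/ i (suc n) = ℚP.toℚᵘ-fromℚᵘ (mkℚᵘ i n)

  toℚᵘ-*-toℚ : ∀ x s → toℚᵘ (x ℚ.* toℚ s) ℚᵘ.≃ toℚᵘ x ℚᵘ.* mkℚᵘ (+ s) 0
  toℚᵘ-*-toℚ x s = ℚᵘP.≃-trans (ℚP.toℚᵘ-homo-* x (toℚ s)) (ℚᵘP.*-congˡ {toℚᵘ x} (toℚᵘ-/ (+ s) 1))

  toℚ≤[p/d]*toℚ⇒ : ∀ {c p d-1 s} .{co : Coprime p (suc d-1)} →
                   toℚ c ℚ.≤ mkℚ (+ p) d-1 co ℚ.* toℚ s → c * suc d-1 ≤ p * s
  toℚ≤[p/d]*toℚ⇒ {c} {p} {d-1} {s} {co} c≤εs
    with ℚᵘP.≤-respˡ-≃ (toℚᵘ-/ (+ c) 1)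
           (ℚᵘP.≤-respʳ-≃ (toℚᵘ-*-toℚ (mkℚ (+ p) d-1 co) s) (ℚP.toℚᵘ-mono-≤ c≤εs))
  ... | *≤* cd≤ps = ℤ.drop‿+≤+ (subst₂ ℤ._≤_ lhs rhs cd≤ps)
    where
    lhs : + c ℤ.* + (suc d-1 * 1) ≡ + (c * suc d-1)
    lhs = trans (sym (ℤ.pos-* c _)) (cong (λ d → + (c * d)) (*-identityʳ (suc d-1)))
    rhs : + p ℤ.* + s ℤ.* + 1 ≡ + (p * s)
    rhs = trans (ℤ.*-identityʳ _) (sym (ℤ.pos-* p s))

  [p/d]<threshold⇒ : ∀ {p d-1 m} .{co : Coprime p (suc d-1)} →
                     mkℚ (+ p) d-1 co ℚ.< threshold (suc m) → p * suc m ^ suc m < m ! * suc d-1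
  [p/d]<threshold⇒ {p} {d-1} {m} ε<θ
    with ℚᵘP.<-respʳ-≃ (toℚᵘ-/ (+ (m !)) (suc m ^ suc m) {{m^n≢0 (suc m) (suc m)}}) (ℚP.toℚᵘ-mono-< ε<θ)
  ... | *<* pK<m!d = ℤ.drop‿+<+ (subst₂ ℤ._<_ lhs (sym (ℤ.pos-* (m !) (suc d-1))) pK<m!d)
    where
    K : ℕ
    K = suc m ^ suc m
    lhs : + p ℤ.* + suc (ℕ.pred K) ≡ + (p * K)
    lhs = trans (sym (ℤ.pos-* p _)) (cong (λ k → + (p * k)) (suc-pred K {{m^n≢0 (suc m) (suc m)}}))

  4*k!≤[1+k]^k : ∀ k → 3 ≤ k → 4 * k ! ≤ suc k ^ k
  4*k!≤[1+k]^k 0                           ()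
  4*k!≤[1+k]^k 1                           (s≤s ())
  4*k!≤[1+k]^k 2                           (s≤s (s≤s ()))
  4*k!≤[1+k]^k 3                           _ = m≤m+n 24 40
  4*k!≤[1+k]^k (suc k@(suc (suc (suc _)))) _ = begin
    4 * (suc k * k !)              ≡⟨ swap 4 (suc k) (k !) ⟩
    suc k * (4 * k !)              ≤⟨ *-monoʳ-≤ (suc k) (4*k!≤[1+k]^k k (s≤s (s≤s (s≤s z≤n)))) ⟩
    suc k * suc k ^ k              ≤⟨ *-mono-≤ (n≤1+n (suc k)) (^-monoˡ-≤ k (n≤1+n (suc k))) ⟩
    suc (suc k) * suc (suc k) ^ k  ∎
    where
    open ≤-Reasoning
    swap : ∀ a b c → a * (b * c) ≡ b * (a * c)
    swap = solve-∀

  threshold⇒4[1+m]*p<d : ∀ {m p d-1} .{co : Coprime p (suc d-1)} → 3 ≤ m →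
                         mkℚ (+ p) d-1 co ℚ.< threshold (suc m) → 4 * suc m * p < suc d-1
  threshold⇒4[1+m]*p<d {m} {p} {d-1} 3≤m ε<θ = *-cancelˡ-< (m !) _ _ (begin-strict
    m ! * (4 * suc m * p)      ≡⟨ rearrange (m !) m p ⟩
    p * (suc m * (4 * m !))    ≤⟨ *-monoʳ-≤ p (*-monoʳ-≤ (suc m) (4*k!≤[1+k]^k m 3≤m)) ⟩
    p * suc m ^ suc m          <⟨ [p/d]<threshold⇒ {p} {d-1} {m} ε<θ ⟩
    m ! * suc d-1              ∎)
    where
    open ≤-Reasoning
    rearrange : ∀ f m p → f * (4 * suc m * p) ≡ p * (suc m * (4 * f))
    rearrange = solve-∀

  c*d≤p*s∧D*p<d⇒D*c≤s : ∀ {c d-1 p s D} → c * suc d-1 ≤ p * s → D * p < suc d-1 → D * c ≤ s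
  c*d≤p*s∧D*p<d⇒D*c≤s {c} {d-1} {p} {s} {D} cd≤ps Dp<d = *-cancelʳ-≤ (D * c) s (suc d-1) (begin
    D * c * suc d-1    ≡⟨ *-assoc D c (suc d-1) ⟩
    D * (c * suc d-1)  ≤⟨ *-monoʳ-≤ D cd≤ps ⟩
    D * (p * s)        ≡⟨ *-assoc D p s ⟨
    D * p * s          ≤⟨ *-monoˡ-≤ s (<⇒≤ Dp<d) ⟩
    suc d-1 * s        ≡⟨ *-comm (suc d-1) s ⟩
    s * suc d-1        ∎)
    where open ≤-Reasoning

  balanced⇒multiplicityBound : ∀ {q n p d-1} .{co : Coprime p (suc d-1)} D (v : Vec (Fin q) n) →
    Balanced (mkℚ (+ p) d-1 co) v → D * p < suc d-1 → MultiplicityBound q D (suppSize v) v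
  balanced⇒multiplicityBound {p = p} {d-1} {co} D v balanced Dp<d a a≢0 =
    c*d≤p*s∧D*p<d⇒D*c≤s {countEq a v} {d-1} {p} {suppSize v} {D}
      (toℚ≤[p/d]*toℚ⇒ {countEq a v} {p} {d-1} {suppSize v} {co} (balanced a a≢0)) Dp<d

  0<1/[1+n] : ∀ n → 0ℚ ℚ.< + 1 / suc n
  0<1/[1+n] n =
    ℚP.toℚᵘ-cancel-< (ℚᵘP.<-respʳ-≃ (ℚᵘP.≃-sym (toℚᵘ-/ (+ 1) (suc n))) (*<* (ℤ.+<+ (s≤s z≤n))))

  1/[1+n]*toℚ≤toℚ : ∀ n {a b} → a ≤ suc n * b → (+ 1 / suc n) ℚ.* toℚ a ℚ.≤ toℚ b
  1/[1+n]*toℚ≤toℚ n {a} {b} a≤[1+n]b = ℚP.toℚᵘ-cancel-≤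
    (ℚᵘP.≤-respʳ-≃ (ℚᵘP.≃-sym (toℚᵘ-/ (+ b) 1))
      (ℚᵘP.≤-respˡ-≃ (ℚᵘP.≃-sym (ℚᵘP.≃-trans (toℚᵘ-*-toℚ (+ 1 / suc n) a)
                                              (ℚᵘP.*-congʳ (toℚᵘ-/ (+ 1) (suc n)))))
        (*≤* (subst₂ ℤ._≤_ lhs rhs (ℤ.+≤+ a≤[1+n]b)))))
    where
    lhs : + a ≡ + 1 ℤ.* + a ℤ.* + 1
    lhs = sym (trans (ℤ.*-identityʳ _) (ℤ.*-identityˡ _))
    rhs : + (suc n * b) ≡ + b ℤ.* + (suc n * 1)
    rhs = trans (cong +_ (trans (*-comm (suc n) b) (cong (b *_) (sym (*-identityʳ (suc n))))))
                (ℤ.pos-* b _)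

open import Data.Nat using (ℕ; _^_)
open import Data.Nat.Divisibility using (_∣_)
open import Data.Nat.Primality using (Prime)
open import Data.Rational using (ℚ; 0ℚ; _<_; _≤_; _*_)
open import Data.Product using (Σ; _×_)

open import Data.Nat using (suc; _!; s≤s)
open import Data.Nat.Properties using (≤-trans; m≤n+m)
open import Data.Rational using (mkℚ; _/_; *<*)
open Counting using (suppSize^[1+k]≤cardB)
open Balance

lemma4p5 : (k : ℕ) → 4 Data.Nat.≤ k → 2 ∣ k →
    (ε : ℚ) → 0ℚ < ε → ε < threshold k →
    Σ ℚ (λ γ → 0ℚ < γ ×
      ((n q : ℕ) → Prime q → (v : Vec (Fin q) n) → Balanced ε v →
        γ * toℚ (suppSize v ^ k) ≤ toℚ (cardB k q v)))
lemma4p5 (suc m) (s≤s 3≤m) _ (mkℚ (+ p) d-1 co) _ ε<θ =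
  + 1 / suc N , 0<1/[1+n] N , λ n q _ v balanced →
    1/[1+n]*toℚ≤toℚ N (≤-trans
      (suppSize^[1+k]≤cardB q m v
        (balanced⇒multiplicityBound (4 Data.Nat.* suc m) v balanced (threshold⇒4[1+m]*p<d 3≤m ε<θ)))
      (m≤n+m _ (cardB (suc m) q v)))
  where
  N : ℕ
  N = 2 ^ suc m Data.Nat.* suc m !
lemma4p5 (suc m) _ _ (mkℚ -[1+ _ ] _ _) (*<* ()) _
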